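{- Let $n \geq 13$. In the $3$-player Zeckendorf game on $n$, no player has a winning strategy.
   Context: Let $F_1=1$, $F_2=2$, $F_{i+1}=F_i+F_{i-1}$. The Zeckendorf game on $n$ starts with the multiset of $n$ copies of $1$. A move is one of: if the list contains $F_{i-1}$ and $F_i$, replace them by $F_{i+1}$; if the list contains two copies of $F_i$: for $i=1$ replace them by $F_2$; for $i=2$ replace them by $F_1,F_3$; for $i\geq 3$ replace them by $F_{i-2},F_{i+1}$. The game ends when the list is the Zeckendorf decomposition of $n$ (distinct, pairwise non-consecutive Fibonacci numbers); every game terminates. In the $p$-player game, players $1,\dots,p$ move in cyclic order $1,2,\dots,p,1,2,\dots$ starting with player 1; the player making the final move wins. A player has a winning strategy if he can choose his moves so that he makes the final move no matter what moves the other players make. -}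

module Defs where

open import Data.Nat using (ℕ; zero; suc; _+_; _≤_)
open import Data.Fin using (Fin; zero; suc)
open import Data.List using (List; _∷_; []; replicate)
open import Data.List.Relation.Binary.Permutation.Propositional using (_↭_)
open import Data.Product using (_×_)
open import Data.Sum using (_⊎_)
open import Relation.Nullary using (¬_)
open import Relation.Binary.PropositionalEquality using (_≢_)

-- Fibonacci numbers with the paper's indexing: fib 1 = 1, fib 2 = 2,
-- fib (i+1) = fib i + fib (i-1).  (fib 0 = 1 is never used by the moves.)
fib : ℕ → ℕ
fib zero = 1
fib (suc zero) = 1
fib (suc (suc zero)) = 2
fib (suc (suc (suc i))) = fib (suc (suc i)) + fib (suc i)

-- A game position is the multiset of numbers on the board, represented as a
-- list considered up to permutation (_↭_).
State : Set
State = List ℕ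

data Move (s t : State) : Set where
  -- F_{i-1}, F_i  ↦  F_{i+1}   (i ≥ 2, written i = j+1 with j ≥ 1)
  combine : (rest : State) (j : ℕ) → 1 ≤ j →
            s ↭ fib j ∷ fib (suc j) ∷ rest →
            t ↭ fib (suc (suc j)) ∷ rest → Move s t
  split1  : (rest : State) →
            s ↭ fib 1 ∷ fib 1 ∷ rest →
            t ↭ fib 2 ∷ rest → Move s t
  split2  : (rest : State) →
            s ↭ fib 2 ∷ fib 2 ∷ rest →
            t ↭ fib 1 ∷ fib 3 ∷ rest → Move s t
  -- F_i, F_i  ↦  F_{i-2}, F_{i+1}   (i ≥ 3, written i = k+3)
  split   : (rest : State) (k : ℕ) →
            s ↭ fib (3 + k) ∷ fib (3 + k) ∷ rest →
            t ↭ fib (1 + k) ∷ fib (4 + k) ∷ rest → Move s t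

-- The game has ended: no legal move remains (equivalently, the board is the
-- Zeckendorf decomposition).
Terminal : State → Set
Terminal s = ∀ t → ¬ Move s t

-- Players of the 3-player game are Fin 3 (player 1 = zero, ...); cyclic order.
next : Fin 3 → Fin 3
next zero = suc zero
next (suc zero) = suc (suc zero)
next (suc (suc zero)) = zero

-- Wins w k s : player w has a winning strategy from position s when it is
-- player k's turn to move (the player making the final move wins).
-- Since every game terminates, this inductive (well-founded) notion coincides
-- with the existence of a winning strategy.
data Wins (w : Fin 3) : Fin 3 → State → Set where
  mine   : ∀ {s} (t : State) → Move s t →
           (Terminal t ⊎ Wins w (next w) t) → Wins w w s
  theirs : ∀ {k s} → k ≢ w →
           (∀ t → Move s t → (¬ Terminal t) × Wins w (next k) t) → Wins w k s

start : ℕ → State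
start n = replicate n 1

{-# OPTIONS --safe #-}
-- Relabelling the players along next shows that nobody can win from a live board both when it
-- is k's turn and when it is next k's turn, as two different players would then both force the
-- last move.  So for each candidate winner w it suffices to reach one live board from the start
-- in two ways whose lengths differ by one, along lines where every move is either chosen by
-- another player or is a move of w after which the next player can reach a prescribed board
-- whatever w chose.
-- The start has 13 + m tokens with m symbolic; the moves of such a board are still enumerated by
-- computation, because the two tokens a move consumes can be taken from a fixed concrete part.
module Submission where

open import Defs
open import Data.Empty using (⊥; ⊥-elim)
open import Data.Fin using (Fin; zero; suc)
open import Data.List using (List; []; _∷_; _++_; [_]; map; concatMap; replicate; upTo)
open import Data.List.Membership.Propositional using (_∈_)
open import Data.List.Membership.Propositional.Properties
  using (∈-++⁺ˡ; ∈-++⁺ʳ; ∈-++⁻; ∈-map⁺; ∈-concatMap⁺; ∈-upTo⁺)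
open import Data.List.Properties using (++-assoc; ≡-dec)
open import Data.List.Relation.Binary.Permutation.Propositional
  using (_↭_; module PermutationReasoning; ↭-refl; ↭-sym; ↭-trans; ↭-prep; ↭-swap; ↭-reflexive)
open import Data.List.Relation.Binary.Permutation.Propositional.Properties
  using (∈-resp-↭; ++⁺ˡ; ++⁺ʳ; drop-∷)
open import Data.List.Relation.Unary.All as All using (All; all?; []; _∷_)
open import Data.List.Relation.Unary.All.Properties using (replicate⁺)
open import Data.List.Relation.Unary.Any as Any using (Any; here; there; any?)
open import Data.Nat using (ℕ; zero; suc; _+_; _∸_; _≤_; z≤n; s≤s; _≤?_; _≟_)
open import Data.Nat.Properties using (≤-decTotalOrder; ≤-trans; +-mono-≤; m≤n+m; m+[n∸m]≡n)
open import Data.List.Sort.InsertionSort.Base ≤-decTotalOrder using (sort)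
open import Data.List.Sort.InsertionSort.Properties ≤-decTotalOrder using (sort-↭)
open import Data.Product using (∃-syntax; _×_; _,_; proj₁; proj₂; map₂)
open import Data.Sum using (inj₁; inj₂)
open import Relation.Binary.PropositionalEquality using (_≡_; _≢_; refl; sym; trans; cong; subst)
open import Relation.Nullary using (¬_; Dec; yes; no; _×-dec_)
open import Relation.Nullary.Decidable using (True; toWitness)

ones : ℕ → List ℕ
ones k = replicate k 1

withOnes : List ℕ → ℕ → State
withOnes xs m = xs ++ ones m

Move-respˡ : ∀ {s s′ t} → s ↭ s′ → Move s t → Move s′ t
Move-respˡ e (combine rest j 1≤j p q) = combine rest j 1≤j (↭-trans (↭-sym e) p) q
Move-respˡ e (split1 rest p q)        = split1 rest (↭-trans (↭-sym e) p) q
Move-respˡ e (split2 rest p q)        = split2 rest (↭-trans (↭-sym e) p) q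
Move-respˡ e (split rest k p q)       = split rest k (↭-trans (↭-sym e) p) q

Move-++⁺ʳ : ∀ {s t} xs → Move s t → Move (s ++ xs) (t ++ xs)
Move-++⁺ʳ xs (combine rest j 1≤j p q) = combine (rest ++ xs) j 1≤j (++⁺ʳ xs p) (++⁺ʳ xs q)
Move-++⁺ʳ xs (split1 rest p q)        = split1 (rest ++ xs) (++⁺ʳ xs p) (++⁺ʳ xs q)
Move-++⁺ʳ xs (split2 rest p q)        = split2 (rest ++ xs) (++⁺ʳ xs p) (++⁺ʳ xs q)
Move-++⁺ʳ xs (split rest k p q)       = split (rest ++ xs) k (++⁺ʳ xs p) (++⁺ʳ xs q)

prev : Fin 3 → Fin 3
prev zero = suc (suc zero)
prev (suc zero) = zero
prev (suc (suc zero)) = suc zero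

prev-next : ∀ k → prev (next k) ≡ k
prev-next zero = refl
prev-next (suc zero) = refl
prev-next (suc (suc zero)) = refl

next-injective : ∀ {k l} → next k ≡ next l → k ≡ l
next-injective {k} {l} e = trans (sym (prev-next k)) (trans (cong prev e) (prev-next l))

next≢ : ∀ k → next k ≢ k
next≢ zero = λ ()
next≢ (suc zero) = λ ()
next≢ (suc (suc zero)) = λ ()

Wins-rotate : ∀ {w k s} → Wins w k s → Wins (next w) (next k) s
Wins-rotate (mine t mv (inj₁ end)) = mine t mv (inj₁ end)
Wins-rotate (mine t mv (inj₂ W))   = mine t mv (inj₂ (Wins-rotate W))
Wins-rotate (theirs k≢w f) =
  theirs (λ e → k≢w (next-injective e)) (λ t mv → proj₁ (f t mv) , Wins-rotate (proj₂ (f t mv)))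

Wins-unique : ∀ {w w′ k s} → w ≢ w′ → Wins w k s → Wins w′ k s → ¬ Terminal s → ⊥
Wins-unique w≢w′ (mine _ _ _) (mine _ _ _) _ = w≢w′ refl
Wins-unique w≢w′ (mine t mv (inj₁ end)) (theirs _ f) _ = proj₁ (f t mv) end
Wins-unique w≢w′ (mine t mv (inj₂ W)) (theirs _ f) _ =
  Wins-unique w≢w′ W (proj₂ (f t mv)) (proj₁ (f t mv))
Wins-unique w≢w′ (theirs _ f) (mine t mv (inj₁ end)) _ = proj₁ (f t mv) end
Wins-unique w≢w′ (theirs _ f) (mine t mv (inj₂ W)) _ =
  Wins-unique w≢w′ (proj₂ (f t mv)) W (proj₁ (f t mv))
Wins-unique w≢w′ (theirs _ f) (theirs _ g) live =
  live (λ t mv → Wins-unique w≢w′ (proj₂ (f t mv)) (proj₂ (g t mv)) (proj₁ (f t mv)))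

Wins-consecutive : ∀ {w k s t} → Wins w k s → Wins w (next k) s → Move s t → ⊥
Wins-consecutive {w} W W′ mv =
  Wins-unique (next≢ w) (Wins-rotate W) W′ (λ end → end _ mv)

Wins-opponent : ∀ {w k s t} → Wins w k s → k ≢ w → Move s t → Wins w (next k) t
Wins-opponent (mine _ _ _) k≢w _ = ⊥-elim (k≢w refl)
Wins-opponent (theirs _ f) _ mv = proj₂ (f _ mv)

Wins-reply : ∀ {w s u} → Wins w w s → (∀ t → Move s t → Move t u) → Wins w (next (next w)) u
Wins-reply (mine t mv (inj₁ end)) reply = ⊥-elim (end _ (reply t mv))
Wins-reply {w} (mine t mv (inj₂ W)) reply = Wins-opponent W (next≢ w) (reply t mv)
Wins-reply (theirs w≢w _) _ = ⊥-elim (w≢w refl)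

picks : {A : Set} → List A → List (A × List A)
picks [] = []
picks (x ∷ xs) = (x , xs) ∷ map (map₂ (x ∷_)) (picks xs)

picks-complete : {A : Set} {a : A} {xs : List A} → a ∈ xs → ∃[ C ] (a , C) ∈ picks xs × xs ↭ a ∷ C
picks-complete {xs = _ ∷ xs} (here refl) = xs , here refl , ↭-refl
picks-complete {a = a} {xs = x ∷ _} (there p) with picks-complete p
... | C , q , e = x ∷ C , there (∈-map⁺ (map₂ (x ∷_)) q) , ↭-trans (↭-prep x e) (↭-swap x a ↭-refl)

∈-++-ones : ∀ D m {a} → a ∈ D ++ ones (suc m) → a ∈ D ++ [ 1 ]
∈-++-ones D m p with ∈-++⁻ D p
... | inj₁ q = ∈-++⁺ˡ q
... | inj₂ q = ∈-++⁺ʳ D (here (All.lookup (replicate⁺ {P = _≡ 1} (suc m) refl) q))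

pick-with-reserve : ∀ D m {a rest} → a ∷ rest ↭ D ++ ones (suc m) →
                    ∃[ C ] (a , C) ∈ picks (D ++ [ 1 ]) × rest ↭ C ++ ones m
pick-with-reserve D m {a} {rest} p with picks-complete (∈-++-ones D m (∈-resp-↭ p (here refl)))
... | C , q , e = C , q , drop-∷ (begin
  a ∷ rest               ↭⟨ p ⟩
  D ++ ones (suc m)      ≡⟨ ++-assoc D [ 1 ] (ones m) ⟨
  (D ++ [ 1 ]) ++ ones m ↭⟨ ++⁺ʳ (ones m) e ⟩
  a ∷ C ++ ones m        ∎)
  where open PermutationReasoning

n≤fib : ∀ n → n ≤ fib n
n≤fib zero = z≤n
n≤fib (suc zero) = s≤s z≤n
n≤fib (suc (suc zero)) = s≤s (s≤s z≤n)
n≤fib (suc (suc (suc i))) =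
  ≤-trans (s≤s (s≤s (m≤n+m (suc i) i))) (+-mono-≤ (n≤fib (suc (suc i))) (n≤fib (suc i)))

when : {A P : Set} → Dec P → List A → List A
when (yes _) xs = xs
when (no _) _ = []

∈-when : {A P : Set} {x : A} {xs : List A} (d : Dec P) → P → x ∈ xs → x ∈ when d xs
∈-when (yes _) _ x∈ = x∈
∈-when (no ¬p) p _ = ⊥-elim (¬p p)

∈-concatMap-at : {A B : Set} (f : A → List B) {x : A} {xs : List A} {y : B} →
                 x ∈ xs → y ∈ f x → y ∈ concatMap f xs
∈-concatMap-at f x∈ y∈ = ∈-concatMap⁺ f (Any.map (λ { refl → y∈ }) x∈)

-- The Fibonacci index i of a combine or split consuming a is searched below a + 1,
-- which suffices because i ≤ fib i.
outcomesAt : ℕ → ℕ → ℕ → List (List ℕ)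
outcomesAt i a b =
  when ((1 ≤? i) ×-dec (fib i ≟ a) ×-dec (fib (suc i) ≟ b)) [ fib (2 + i) ∷ [] ] ++
  when ((fib (3 + i) ≟ a) ×-dec (fib (3 + i) ≟ b)) [ fib (1 + i) ∷ fib (4 + i) ∷ [] ]

outcomes : ℕ → ℕ → List (List ℕ)
outcomes a b =
  when ((a ≟ 1) ×-dec (b ≟ 1)) [ fib 2 ∷ [] ] ++
  when ((a ≟ 2) ×-dec (b ≟ 2)) [ fib 1 ∷ fib 3 ∷ [] ] ++
  concatMap (λ i → outcomesAt i a b) (upTo (suc a))

outcomesAt⊆outcomes : ∀ {a b out} i → i ≤ a → out ∈ outcomesAt i a b → out ∈ outcomes a b
outcomesAt⊆outcomes {a} {b} i i≤a out∈ =
  ∈-++⁺ʳ (when ((a ≟ 1) ×-dec (b ≟ 1)) _) (∈-++⁺ʳ (when ((a ≟ 2) ×-dec (b ≟ 2)) _)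
    (∈-concatMap-at (λ i → outcomesAt i a b) (∈-upTo⁺ (s≤s i≤a)) out∈))

combine∈outcomes : ∀ j → 1 ≤ j → fib (2 + j) ∷ [] ∈ outcomes (fib j) (fib (suc j))
combine∈outcomes j 1≤j = outcomesAt⊆outcomes j (n≤fib j)
  (∈-++⁺ˡ (∈-when ((1 ≤? j) ×-dec (fib j ≟ fib j) ×-dec (fib (suc j) ≟ fib (suc j))) (1≤j , refl , refl) (here refl)))

split1∈outcomes : fib 2 ∷ [] ∈ outcomes (fib 1) (fib 1)
split1∈outcomes = here refl

split2∈outcomes : fib 1 ∷ fib 3 ∷ [] ∈ outcomes (fib 2) (fib 2)
split2∈outcomes = here refl

split∈outcomes : ∀ k → fib (1 + k) ∷ fib (4 + k) ∷ [] ∈ outcomes (fib (3 + k)) (fib (3 + k))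
split∈outcomes k = outcomesAt⊆outcomes k (≤-trans (m≤n+m k 3) (n≤fib (3 + k)))
  (∈-++⁺ʳ (when ((1 ≤? k) ×-dec (fib k ≟ a) ×-dec (fib (suc k) ≟ a)) [ fib (2 + k) ∷ [] ])
    (∈-when ((fib (3 + k) ≟ a) ×-dec (fib (3 + k) ≟ a)) (refl , refl) (here refl)))
  where a = fib (3 + k)

-- Up to permutation and appending ones m, the boards reachable in one move from
-- D ++ ones (2 + m): the two tokens consumed can be taken from D and two of the ones.
successors : List ℕ → List (List ℕ)
successors D = concatMap afterFirst (picks (D ++ [ 1 ]))
  where
  afterFirst : ℕ × List ℕ → List (List ℕ)
  afterFirst (a , C₁) = concatMap (λ (b , C₂) → map (_++ C₂) (outcomes a b)) (picks (C₁ ++ [ 1 ]))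

successor-of-pair : ∀ D m {a b rest out t} → out ∈ outcomes a b →
                    D ++ ones (2 + m) ↭ a ∷ b ∷ rest → t ↭ out ++ rest →
                    ∃[ u ] u ∈ successors D × t ↭ u ++ ones m
successor-of-pair D m {rest = rest} {out} {t} out∈ p q with pick-with-reserve D (suc m) (↭-sym p)
... | C₁ , a∈ , e₁ with pick-with-reserve C₁ m e₁
... | C₂ , b∈ , e₂ =
  out ++ C₂ ,
  ∈-concatMap-at _ a∈ (∈-concatMap-at _ b∈ (∈-map⁺ (_++ C₂) out∈)) ,
  (begin
    t                    ↭⟨ q ⟩
    out ++ rest          ↭⟨ ++⁺ˡ out e₂ ⟩
    out ++ C₂ ++ ones m  ≡⟨ ++-assoc out C₂ (ones m) ⟨
    (out ++ C₂) ++ ones m ∎)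
  where open PermutationReasoning

successors-complete : ∀ D m {t} → Move (D ++ ones (2 + m)) t → ∃[ u ] u ∈ successors D × t ↭ u ++ ones m
successors-complete D m (combine _ j 1≤j p q) = successor-of-pair D m (combine∈outcomes j 1≤j) p q
successors-complete D m (split1 _ p q)        = successor-of-pair D m split1∈outcomes p q
successors-complete D m (split2 _ p q)        = successor-of-pair D m split2∈outcomes p q
successors-complete D m (split _ k p q)       = successor-of-pair D m (split∈outcomes k) p q

sorted-↭ : ∀ {xs ys} → sort xs ≡ sort ys → xs ↭ ys
sorted-↭ {xs} {ys} e = ↭-trans (↭-sym (sort-↭ xs)) (↭-trans (↭-reflexive e) (sort-↭ ys))

Covers : List (List ℕ) → List (List ℕ) → Set
Covers xs us = All (λ u → Any (λ x → sort u ≡ sort x) xs) us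

covers? : ∀ xs us → Dec (Covers xs us)
covers? xs = all? (λ u → any? (λ x → ≡-dec _≟_ (sort u) (sort x)) xs)

replies-to : ∀ D m (xs : List (List ℕ)) {v} → {True (covers? xs (successors D))} →
             All (λ x → Move x v) xs →
             ∀ t → Move (D ++ ones (2 + m)) t → Move t (v ++ ones m)
replies-to D m xs {_} {covers} moves t mv with successors-complete D m mv
... | u , u∈ , t↭u with All.lookupAny moves (All.lookup (toWitness covers) u∈)
... | x⇒v , sort-u≡sort-x =
  Move-respˡ (↭-sym t↭u) (Move-++⁺ʳ (ones m) (Move-respˡ (sorted-↭ (sym sort-u≡sort-x)) x⇒v))

-- A board of 13 tokens is named by its tokens other than 1.
⟨⟩ ⟨2⟩ ⟨3⟩ ⟨2,2⟩ ⟨3,2⟩ ⟨5⟩ ⟨3,3⟩ ⟨5,2⟩ ⟨3,3,2⟩ ⟨5,2,2⟩ : List ℕ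
⟨⟩      = ones 13
⟨2⟩     = 2 ∷ ones 11
⟨3⟩     = 3 ∷ ones 10
⟨2,2⟩   = 2 ∷ 2 ∷ ones 9
⟨3,2⟩   = 3 ∷ 2 ∷ ones 8
⟨5⟩     = 5 ∷ ones 8
⟨3,3⟩   = 3 ∷ 3 ∷ ones 7
⟨5,2⟩   = 5 ∷ 2 ∷ ones 6
⟨3,3,2⟩ = 3 ∷ 3 ∷ 2 ∷ ones 5
⟨5,2,2⟩ = 5 ∷ 2 ∷ 2 ∷ ones 4

⟨⟩⇒⟨2⟩ : Move ⟨⟩ ⟨2⟩
⟨⟩⇒⟨2⟩ = split1 (ones 11) (sorted-↭ refl) (sorted-↭ refl)

⟨2⟩⇒⟨3⟩ : Move ⟨2⟩ ⟨3⟩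
⟨2⟩⇒⟨3⟩ = combine (ones 10) 1 (s≤s z≤n) (sorted-↭ refl) (sorted-↭ refl)

⟨2⟩⇒⟨2,2⟩ : Move ⟨2⟩ ⟨2,2⟩
⟨2⟩⇒⟨2,2⟩ = split1 (2 ∷ ones 9) (sorted-↭ refl) (sorted-↭ refl)

⟨2,2⟩⇒⟨3⟩ : Move ⟨2,2⟩ ⟨3⟩
⟨2,2⟩⇒⟨3⟩ = split2 (ones 9) (sorted-↭ refl) (sorted-↭ refl)

⟨3⟩⇒⟨3,2⟩ : Move ⟨3⟩ ⟨3,2⟩
⟨3⟩⇒⟨3,2⟩ = split1 (3 ∷ ones 8) (sorted-↭ refl) (sorted-↭ refl)

⟨2,2⟩⇒⟨3,2⟩ : Move ⟨2,2⟩ ⟨3,2⟩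
⟨2,2⟩⇒⟨3,2⟩ = combine (2 ∷ ones 8) 1 (s≤s z≤n) (sorted-↭ refl) (sorted-↭ refl)

⟨3,2⟩⇒⟨5⟩ : Move ⟨3,2⟩ ⟨5⟩
⟨3,2⟩⇒⟨5⟩ = combine (ones 8) 2 (s≤s z≤n) (sorted-↭ refl) (sorted-↭ refl)

⟨3,2⟩⇒⟨3,3⟩ : Move ⟨3,2⟩ ⟨3,3⟩
⟨3,2⟩⇒⟨3,3⟩ = combine (3 ∷ ones 7) 1 (s≤s z≤n) (sorted-↭ refl) (sorted-↭ refl)

⟨5⟩⇒⟨5,2⟩ : Move ⟨5⟩ ⟨5,2⟩
⟨5⟩⇒⟨5,2⟩ = split1 (5 ∷ ones 6) (sorted-↭ refl) (sorted-↭ refl)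

⟨3,3⟩⇒⟨5⟩ : Move ⟨3,3⟩ ⟨5⟩
⟨3,3⟩⇒⟨5⟩ = split (ones 7) 0 (sorted-↭ refl) (sorted-↭ refl)

⟨3,3,2⟩⇒⟨5,2⟩ : Move ⟨3,3,2⟩ ⟨5,2⟩
⟨3,3,2⟩⇒⟨5,2⟩ = split (2 ∷ ones 5) 0 (sorted-↭ refl) (sorted-↭ refl)

⟨5,2⟩⇒⟨5,2,2⟩ : Move ⟨5,2⟩ ⟨5,2,2⟩
⟨5,2⟩⇒⟨5,2,2⟩ = split1 (5 ∷ 2 ∷ ones 4) (sorted-↭ refl) (sorted-↭ refl)

⟨5,2,2⟩⇒⟨5,2,2,2⟩ : Move ⟨5,2,2⟩ (5 ∷ 2 ∷ 2 ∷ 2 ∷ ones 2)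
⟨5,2,2⟩⇒⟨5,2,2,2⟩ = split1 (5 ∷ 2 ∷ 2 ∷ ones 2) (sorted-↭ refl) (sorted-↭ refl)

module _ (m : ℕ) where

  private
    ⇑ : ∀ {x v} → Move x v → Move (withOnes x m) (withOnes v m)
    ⇑ = Move-++⁺ʳ (ones m)

  first-player-cannot-win : ¬ Wins zero zero (withOnes ⟨⟩ m)
  first-player-cannot-win W = Wins-consecutive via⟨3⟩ via⟨2,2⟩ (⇑ ⟨3⟩⇒⟨3,2⟩)
    where
    reply : ∀ {v} → Move ⟨2⟩ v → ∀ t → Move (withOnes ⟨⟩ m) t → Move t (withOnes v m)
    reply mv = replies-to (ones 11) m (⟨2⟩ ∷ []) (mv ∷ [])
    via⟨3⟩ : Wins zero (suc (suc zero)) (withOnes ⟨3⟩ m)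
    via⟨3⟩ = Wins-reply W (reply ⟨2⟩⇒⟨3⟩)
    via⟨2,2⟩ : Wins zero zero (withOnes ⟨3⟩ m)
    via⟨2,2⟩ = Wins-opponent (Wins-reply W (reply ⟨2⟩⇒⟨2,2⟩)) (λ ()) (⇑ ⟨2,2⟩⇒⟨3⟩)

  second-player-cannot-win : ¬ Wins (suc zero) zero (withOnes ⟨⟩ m)
  second-player-cannot-win W = Wins-consecutive via⟨5⟩ via⟨3,3⟩ (⇑ ⟨5,2,2⟩⇒⟨5,2,2,2⟩)
    where
    at⟨3,2⟩ : Wins (suc zero) zero (withOnes ⟨3,2⟩ m)
    at⟨3,2⟩ = Wins-reply (Wins-opponent W (λ ()) (⇑ ⟨⟩⇒⟨2⟩))
      (replies-to (2 ∷ ones 9) m (⟨3⟩ ∷ ⟨2,2⟩ ∷ []) (⟨3⟩⇒⟨3,2⟩ ∷ ⟨2,2⟩⇒⟨3,2⟩ ∷ []))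
    via⟨5⟩ : Wins (suc zero) zero (withOnes ⟨5,2,2⟩ m)
    via⟨5⟩ = Wins-reply (Wins-opponent at⟨3,2⟩ (λ ()) (⇑ ⟨3,2⟩⇒⟨5⟩))
      (replies-to (5 ∷ ones 6) m (⟨5,2⟩ ∷ []) (⟨5,2⟩⇒⟨5,2,2⟩ ∷ []))
    via⟨3,3⟩ : Wins (suc zero) (suc zero) (withOnes ⟨5,2,2⟩ m)
    via⟨3,3⟩ = Wins-opponent
      (Wins-reply (Wins-opponent at⟨3,2⟩ (λ ()) (⇑ ⟨3,2⟩⇒⟨3,3⟩))
        (replies-to (3 ∷ 3 ∷ ones 5) m (⟨5⟩ ∷ ⟨3,3,2⟩ ∷ []) (⟨5⟩⇒⟨5,2⟩ ∷ ⟨3,3,2⟩⇒⟨5,2⟩ ∷ [])))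
      (λ ()) (⇑ ⟨5,2⟩⇒⟨5,2,2⟩)

  third-player-cannot-win : ¬ Wins (suc (suc zero)) zero (withOnes ⟨⟩ m)
  third-player-cannot-win W = Wins-consecutive via⟨5⟩ via⟨3,3⟩ (⇑ ⟨5⟩⇒⟨5,2⟩)
    where
    at⟨3⟩ : Wins (suc (suc zero)) (suc (suc zero)) (withOnes ⟨3⟩ m)
    at⟨3⟩ = Wins-opponent (Wins-opponent W (λ ()) (⇑ ⟨⟩⇒⟨2⟩)) (λ ()) (⇑ ⟨2⟩⇒⟨3⟩)
    reply : ∀ {v} → Move ⟨3,2⟩ v → ∀ t → Move (withOnes ⟨3⟩ m) t → Move t (withOnes v m)
    reply mv = replies-to (3 ∷ ones 8) m (⟨3,2⟩ ∷ []) (mv ∷ [])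
    via⟨5⟩ : Wins (suc (suc zero)) (suc zero) (withOnes ⟨5⟩ m)
    via⟨5⟩ = Wins-reply at⟨3⟩ (reply ⟨3,2⟩⇒⟨5⟩)
    via⟨3,3⟩ : Wins (suc (suc zero)) (suc (suc zero)) (withOnes ⟨5⟩ m)
    via⟨3,3⟩ = Wins-opponent (Wins-reply at⟨3⟩ (reply ⟨3,2⟩⇒⟨3,3⟩)) (λ ()) (⇑ ⟨3,3⟩⇒⟨5⟩)

  no-winner : ∀ w → ¬ Wins w zero (start (13 + m))
  no-winner zero             = first-player-cannot-win
  no-winner (suc zero)       = second-player-cannot-win
  no-winner (suc (suc zero)) = third-player-cannot-win

lemma2p1p2 : (n : ℕ) → 13 ≤ n → (w : Fin 3) → ¬ Wins w zero (start n)
lemma2p1p2 n 13≤n w W = no-winner (n ∸ 13) w (subst (λ k → Wins w zero (start k)) (sym (m+[n∸m]≡n 13≤n)) W)
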